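{- Let $t$ be a plane tree. Define nodes $\varnothing=u_0\preceq u_1\preceq\dots\preceq u_k$ where, for each $0\le i<k$, $u_{i+1}$ is the unique child of $u_i$ with $|\theta_{u_{i+1}}t|\ge\frac12|t|$, and $k\ge0$ is the first index for which no such child exists. Then $\Phi(t)\le\prod_{i=1}^k\frac{1}{1-|\theta_{u_i}t|/|t|}$.
   Context: $\mathbb{U}$ is the set of finite words over $\{1,2,\dots\}$ with empty word $\varnothing$; $u*v$ concatenation, and the children of $u$ in $t$ are the $u*j\in t$; $u\preceq v$ means $u$ is a prefix of $v$; for $u\ne\varnothing$, $\overleftarrow u$ is $u$ minus its last letter. A plane tree is a finite $t\subset\mathbb{U}$ with $\varnothing\in t$, $\overleftarrow u\in t$ for all $u\in t\setminus\{\varnothing\}$, and such that for each $u\in t$ there is $k_u(t)\ge0$ with $u*j\in t\iff1\le j\le k_u(t)$. $\theta_ut=\{v:u*v\in t\}$. Centrality: $\varphi_t(u)=\prod_{v\in t,\,v\not\preceq u}|\theta_vt|\cdot\prod_{v\in t,\,\varnothing\ne v\preceq u}(|t|-|\theta_vt|)$; competitive ratio $\Phi(t)=\varphi_t(\varnothing)/\min_{w\in t}\varphi_t(w)$. -}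

module Defs where

open import Data.Nat as ℕ using (ℕ; zero; suc; _+_; _*_; _∸_; _⊓_)
open import Data.Bool using (Bool; true; false; if_then_else_; not; _∧_)
open import Data.List using (List; []; _∷_; _++_; [_]; concat; map; foldr; length; filter)
open import Data.List.Membership.Propositional using (_∈_)
open import Data.Integer using (+_)
open import Data.Rational as ℚ using (ℚ; 0ℚ; 1ℚ; _÷_; _-_; ≢-nonZero)
open import Data.Rational.Properties using (_≟_)
open import Relation.Nullary using (¬_; yes; no)
open import Relation.Unary using (Decidable)
open import Relation.Nullary.Decidable using (T?)

data Tree : Set where
  node : List Tree → Tree

-- Words of 𝕌 : finite sequences of positive integers (we only ever produce
-- positive letters; child j is labelled j, 1-based).
Word : Set
Word = List ℕ

-- The set of nodes of a plane tree, as a list of words (Ulam–Harris labelling).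
mutual
  nodes : Tree → List Word
  nodes (node ts) = [] ∷ nodesChildren 1 ts

  nodesChildren : ℕ → List Tree → List Word
  nodesChildren j []       = []
  nodesChildren j (t ∷ ts) = map (j ∷_) (nodes t) ++ nodesChildren (suc j) ts

⟦_⟧ : Tree → List Word
⟦ t ⟧ = nodes t

∣_∣ : Tree → ℕ
∣ t ∣ = length ⟦ t ⟧

prefix? : Word → Word → Bool
prefix? []       _        = true
prefix? (_ ∷ _)  []       = false
prefix? (a ∷ u)  (b ∷ v)  = (a ℕ.≡ᵇ b) ∧ prefix? u v

-- |θ_u t| = #{ v : u * v ∈ t } = #{ w ∈ t : u ⪯ w }
θsize : Tree → Word → ℕ
θsize t u = length (filter (λ w → T? (prefix? u w)) ⟦ t ⟧)

nonEmpty : Word → Bool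
nonEmpty []      = false
nonEmpty (_ ∷ _) = true

prod : List ℕ → ℕ
prod = foldr _*_ 1

φ : Tree → Word → ℕ
φ t u =
  prod (map (θsize t) (filter (λ v → T? (not (prefix? v u))) ⟦ t ⟧))
  * prod (map (λ v → ∣ t ∣ ∸ θsize t v)
              (filter (λ v → T? (nonEmpty v ∧ prefix? v u)) ⟦ t ⟧))

-- min_{w ∈ t} φ_t(w)   (the node list contains ∅, so starting the fold at φ_t(∅) is harmless)
minφ : Tree → ℕ
minφ t = foldr (λ w m → φ t w ⊓ m) (φ t []) ⟦ t ⟧

-- division of rationals, total (junk value 0 when the divisor is 0)
_÷'_ : ℚ → ℚ → ℚ
p ÷' q with q ≟ 0ℚ
... | yes _  = 0ℚ
... | no q≢0 = _÷_ p q {{≢-nonZero q≢0}}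

ℕ→ℚ : ℕ → ℚ
ℕ→ℚ n = (+ n) ℚ./ 1

Φ : Tree → ℚ
Φ t = ℕ→ℚ (φ t []) ÷' ℕ→ℚ (minφ t)

-- Heavy path: Chain t u us says that us = u_{i+1}, …, u_k continues the path from u = u_i:
-- each next node is a child u*j ∈ t with |θ_{u*j} t| ≥ |t|/2, and the path stops at
-- the first node having no such child.
data Chain (t : Tree) : Word → List Word → Set where
  stop : ∀ {u} →
         (∀ j → (u ++ [ j ]) ∈ ⟦ t ⟧ → ¬ (ℕ→ℚ ∣ t ∣ ÷' ℕ→ℚ 2 ℚ.≤ ℕ→ℚ (θsize t (u ++ [ j ])))) →
         Chain t u []
  step : ∀ {u j us} →
         (u ++ [ j ]) ∈ ⟦ t ⟧ →
         ℕ→ℚ ∣ t ∣ ÷' ℕ→ℚ 2 ℚ.≤ ℕ→ℚ (θsize t (u ++ [ j ])) →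
         Chain t (u ++ [ j ]) us →
         Chain t u ((u ++ [ j ]) ∷ us)

prodℚ : List ℚ → ℚ
prodℚ = foldr ℚ._*_ 1ℚ

bound : Tree → List Word → ℚ
bound t us = prodℚ (map (λ u → 1ℚ ÷' (1ℚ - (ℕ→ℚ (θsize t u) ÷' ℕ→ℚ ∣ t ∣))) us)

-- Writing θ_v for |θ_v t|, the ratio φ_t(∅) / φ_t(w) is the product of θ_v / (|t| − θ_v)
-- over the nodes ∅ ≠ v ⪯ w, because every other node contributes the same factor θ_v to both
-- centralities.  Going down from the root to w, the heavy ancestors (θ_v ≥ |t|/2) come first
-- and are the first nodes u₁, …, uᵢ of the heavy path, since two siblings cannot both be
-- heavy; for them θ_v ≤ |t| bounds the factor by |t| / (|t| − θ_v).  The ancestors below the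
-- first light one are light too, as θ decreases along the path, so their factors are at most 1,
-- while the skipped factors |t| / (|t| − θ_{u_j}), j > i, are at least 1.  Cleared of
-- denominators, this is φ_t(∅) ∏ⱼ (|t| − θ_{u_j}) ≤ |t|^k φ_t(w) in ℕ, applied to a w minimising φ_t.
module Submission where

open import Defs
open import Data.List using (List; [])
open import Data.Rational using (_≤_)

open import Algebra.Bundles using (CommutativeMonoid)
open import Data.Bool using (Bool; true; false; T; not; _∧_)
open import Data.Bool.Properties using (T-∧; T-≡)
open import Data.Empty using (⊥; ⊥-elim)
import Data.Integer as ℤ
import Data.Integer.Properties as ℤ
open import Data.List using (_∷_; _++_; [_]; map; length; filter; filterᵇ)
open import Data.List.Properties
  using (filter-++; filter-all; filter-none; filter-reject; length-filter; ++-identityʳ; foldr-map)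
open import Data.List.Membership.Propositional using (_∈_)
open import Data.List.Membership.Propositional.Properties using (∈-++⁻; ∈-map⁻; ∈-filter⁻; foldr-selective)
open import Data.List.Relation.Unary.All as All using (All; []; _∷_)
import Data.List.Relation.Unary.All.Properties as All
open import Data.List.Relation.Unary.Any using (here; there)
open import Data.List.Relation.Binary.Prefix.Heterogeneous using (Prefix; []; _∷_)
import Data.List.Relation.Binary.Prefix.Heterogeneous.Properties as Prefix
open import Data.List.Relation.Binary.Sublist.Propositional using (⊆-refl)
open import Data.List.Relation.Binary.Sublist.Propositional.Properties using (filter⁺; length-mono-≤)
open import Data.Nat as ℕ using (ℕ; zero; suc; _+_; _*_; _∸_; _^_)
import Data.Nat.Properties as ℕ
import Data.Nat.Coprimality as Coprime
open import Data.Product using (∃-syntax; _×_; _,_; proj₁)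
open import Data.Rational as ℚ using (mkℚ; 0ℚ; 1ℚ; _÷_; _-_; 1/_; Positive; NonZero; ≢-nonZero)
import Data.Rational.Properties as ℚ
import Data.Rational.Solver as ℚ-Solver
open import Data.Sum using (inj₁; inj₂)
open import Function using (_∘_)
open import Function.Bundles using (_⇔_; mk⇔; Equivalence)
import Function.Properties.Equivalence as ⇔
open import Relation.Binary.PropositionalEquality hiding ([_])
open import Relation.Nullary using (¬_; yes; no)
open import Relation.Nullary.Decidable using (T?)
open import Relation.Unary using (Decidable)

import Algebra.Properties.CommutativeSemigroup ℕ.*-commutativeSemigroup as ℕ-*
import Algebra.Properties.CommutativeSemigroup
  (CommutativeMonoid.commutativeSemigroup ℚ.*-1-commutativeMonoid) as ℚ-*

filterᵇ-map : ∀ {A B : Set} (p : B → Bool) (f : A → B) xs →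
              filterᵇ p (map f xs) ≡ map f (filterᵇ (p ∘ f) xs)
filterᵇ-map p f []       = refl
filterᵇ-map p f (x ∷ xs) with p (f x)
... | true  = cong (f x ∷_) (filterᵇ-map p f xs)
... | false = filterᵇ-map p f xs

filterᵇ-cong : ∀ {A : Set} {p q : A → Bool} {xs} → All (λ x → p x ≡ q x) xs → filterᵇ p xs ≡ filterᵇ q xs
filterᵇ-cong         {xs = []}     []             = refl
filterᵇ-cong {q = q} {xs = x ∷ xs} (px≡qx ∷ eqs) rewrite px≡qx with q x
... | true  = cong (x ∷_) (filterᵇ-cong eqs)
... | false = filterᵇ-cong eqs

length-filter-disjoint : ∀ {A : Set} {P Q : A → Set} (P? : Decidable P) (Q? : Decidable Q) →
                         (∀ {x} → P x → Q x → ⊥) → ∀ xs →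
                         length (filter P? xs) + length (filter Q? xs) ℕ.≤ length xs
length-filter-disjoint P? Q? disjoint []       = ℕ.z≤n
length-filter-disjoint P? Q? disjoint (x ∷ xs) with ih ← length-filter-disjoint P? Q? disjoint xs | P? x | Q? x
... | yes px | yes qx = ⊥-elim (disjoint px qx)
... | yes _  | no  _  = ℕ.s≤s ih
... | no  _  | yes _  = subst (ℕ._≤ suc (length xs)) (sym (ℕ.+-suc _ _)) (ℕ.s≤s ih)
... | no  _  | no  _  = ℕ.m≤n⇒m≤1+n ih

prod-map-filter : ∀ {A : Set} (f : A → ℕ) (p : A → Bool) xs →
                  prod (map f xs) ≡ prod (map f (filterᵇ p xs)) * prod (map f (filterᵇ (not ∘ p) xs))
prod-map-filter f p []       = refl
prod-map-filter f p (x ∷ xs) rewrite prod-map-filter f p xs with p x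
... | true  = sym (ℕ.*-assoc (f x) (prod (map f (filterᵇ p xs))) (prod (map f (filterᵇ (not ∘ p) xs))))
... | false = ℕ-*.x∙yz≈y∙xz (f x) (prod (map f (filterᵇ p xs))) (prod (map f (filterᵇ (not ∘ p) xs)))

prod-map-mono-≤ : ∀ {A : Set} {f g : A → ℕ} {xs} → All (λ x → f x ℕ.≤ g x) xs →
                  prod (map f xs) ℕ.≤ prod (map g xs)
prod-map-mono-≤ []             = ℕ.≤-refl
prod-map-mono-≤ (fx≤gx ∷ f≤g) = ℕ.*-mono-≤ fx≤gx (prod-map-mono-≤ f≤g)

prod-map-≤-^ : ∀ {A : Set} {f : A → ℕ} {m} → (∀ x → f x ℕ.≤ m) → ∀ xs →
               prod (map f xs) ℕ.≤ m ^ length xs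
prod-map-≤-^ f≤m []       = ℕ.≤-refl
prod-map-≤-^ f≤m (x ∷ xs) = ℕ.*-mono-≤ (f≤m x) (prod-map-≤-^ f≤m xs)

n*2≡n+n : ∀ n → n * 2 ≡ n + n
n*2≡n+n n = trans (ℕ.*-comm n 2) (cong (n +_) (ℕ.+-identityʳ n))

*-mono-≤-interchange : ∀ {a b p c k q} e → a ℕ.≤ b → p * c ℕ.≤ k * q → a * p * (e * c) ℕ.≤ b * k * (e * q)
*-mono-≤-interchange {a} {b} {p} {c} {k} {q} e a≤b pc≤kq = begin
  a * p * (e * c)   ≡⟨ ℕ-*.interchange a p e c ⟩
  a * e * (p * c)   ≤⟨ ℕ.*-mono-≤ (ℕ.*-monoˡ-≤ e a≤b) pc≤kq ⟩
  b * e * (k * q)   ≡⟨ ℕ-*.interchange b e k q ⟩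
  b * k * (e * q)   ∎
  where open ℕ.≤-Reasoning

ℕ→ℚ-mkℚ : ∀ n → ℕ→ℚ n ≡ mkℚ (ℤ.+ n) 0 (Coprime.sym (Coprime.1-coprimeTo n))
ℕ→ℚ-mkℚ n = ℚ.↥p/↧p≡p (mkℚ (ℤ.+ n) 0 _)

ℕ→ℚ-+ : ∀ m n → ℕ→ℚ (m + n) ≡ ℕ→ℚ m ℚ.+ ℕ→ℚ n
ℕ→ℚ-+ m n = begin
  ℤ.+ (m + n) ℚ./ 1
    ≡⟨ cong (ℚ._/ 1) (ℤ.pos-+ m n) ⟩
  (ℤ.+ m ℤ.+ ℤ.+ n) ℚ./ 1
    ≡⟨ cong₂ (λ i j → (i ℤ.+ j) ℚ./ 1) (ℤ.*-identityʳ (ℤ.+ m)) (ℤ.*-identityʳ (ℤ.+ n)) ⟨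
  (ℤ.+ m ℤ.* ℤ.+ 1 ℤ.+ ℤ.+ n ℤ.* ℤ.+ 1) ℚ./ 1
    ≡⟨ cong₂ ℚ._+_ (ℕ→ℚ-mkℚ m) (ℕ→ℚ-mkℚ n) ⟨
  ℕ→ℚ m ℚ.+ ℕ→ℚ n
    ∎
  where open ≡-Reasoning

ℕ→ℚ-* : ∀ m n → ℕ→ℚ (m * n) ≡ ℕ→ℚ m ℚ.* ℕ→ℚ n
ℕ→ℚ-* m n = trans (cong (ℚ._/ 1) (ℤ.pos-* m n)) (sym (cong₂ ℚ._*_ (ℕ→ℚ-mkℚ m) (ℕ→ℚ-mkℚ n)))

ℕ→ℚ-mono-≤ : ∀ {m n} → m ℕ.≤ n → ℕ→ℚ m ≤ ℕ→ℚ n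
ℕ→ℚ-mono-≤ {m} {n} m≤n = subst₂ _≤_ (sym (ℕ→ℚ-mkℚ m)) (sym (ℕ→ℚ-mkℚ n))
  (ℚ.*≤* (subst₂ ℤ._≤_ (sym (ℤ.*-identityʳ (ℤ.+ m))) (sym (ℤ.*-identityʳ (ℤ.+ n))) (ℤ.+≤+ m≤n)))

ℕ→ℚ-cancel-≤ : ∀ {m n} → ℕ→ℚ m ≤ ℕ→ℚ n → m ℕ.≤ n
ℕ→ℚ-cancel-≤ {m} {n} m≤n with ℚ.*≤* m≤n′ ← subst₂ _≤_ (ℕ→ℚ-mkℚ m) (ℕ→ℚ-mkℚ n) m≤n =
  ℤ.drop‿+≤+ (subst₂ ℤ._≤_ (ℤ.*-identityʳ (ℤ.+ m)) (ℤ.*-identityʳ (ℤ.+ n)) m≤n′)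

ℕ→ℚ-suc≢0 : ∀ n → ℕ→ℚ (suc n) ≢ 0ℚ
ℕ→ℚ-suc≢0 n eq with () ← trans (sym (ℕ→ℚ-mkℚ (suc n))) eq

ℕ→ℚ-suc-positive : ∀ n → Positive (ℕ→ℚ (suc n))
ℕ→ℚ-suc-positive n = subst Positive (sym (ℕ→ℚ-mkℚ (suc n))) _

÷'-≢0 : ∀ p {q} (q≢0 : q ≢ 0ℚ) → p ÷' q ≡ (p ÷ q) {{≢-nonZero q≢0}}
÷'-≢0 p {q} q≢0 with q ℚ.≟ 0ℚ
... | yes q≡0 = ⊥-elim (q≢0 q≡0)
... | no _    = refl

p÷r*r≡p : ∀ p r .{{_ : NonZero r}} → p ÷ r ℚ.* r ≡ p
p÷r*r≡p p r = begin
  p ℚ.* 1/ r ℚ.* r   ≡⟨ ℚ.*-assoc p (1/ r) r ⟩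
  p ℚ.* (1/ r ℚ.* r) ≡⟨ cong (p ℚ.*_) (ℚ.*-inverseˡ r) ⟩
  p ℚ.* 1ℚ           ≡⟨ ℚ.*-identityʳ p ⟩
  p                  ∎
  where open ≡-Reasoning

÷-≤⇔≤-* : ∀ {p q} r .{{_ : Positive r}} → (p ÷ r) {{ℚ.pos⇒nonZero r}} ≤ q ⇔ p ≤ q ℚ.* r
÷-≤⇔≤-* {p} {q} r = mk⇔
  (λ p/r≤q → subst (_≤ q ℚ.* r) (p÷r*r≡p p r) (ℚ.*-monoʳ-≤-nonNeg r p/r≤q))
  (λ p≤qr → ℚ.*-cancelʳ-≤-pos r (subst (_≤ q ℚ.* r) (sym (p÷r*r≡p p r)) p≤qr))
  where instance _ = ℚ.pos⇒nonZero r
                 _ = ℚ.pos⇒nonNeg r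

1÷'x*[x*y]≡y : ∀ x y → x ≢ 0ℚ → (1ℚ ÷' x) ℚ.* (x ℚ.* y) ≡ y
1÷'x*[x*y]≡y x y x≢0 = begin
  (1ℚ ÷' x) ℚ.* (x ℚ.* y)   ≡⟨ cong (ℚ._* (x ℚ.* y)) (÷'-≢0 1ℚ x≢0) ⟩
  1ℚ ÷ x ℚ.* (x ℚ.* y)      ≡⟨ cong (ℚ._* (x ℚ.* y)) (ℚ.*-identityˡ (1/ x)) ⟩
  1/ x ℚ.* (x ℚ.* y)        ≡⟨ ℚ.*-assoc (1/ x) x y ⟨
  1/ x ℚ.* x ℚ.* y          ≡⟨ cong (ℚ._* y) (ℚ.*-inverseˡ x) ⟩
  1ℚ ℚ.* y                  ≡⟨ ℚ.*-identityˡ y ⟩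
  y                         ∎
  where open ≡-Reasoning
        instance _ = ≢-nonZero x≢0

[1-t÷n]*n≡d : ∀ {d t n} .{{_ : NonZero n}} → d ℚ.+ t ≡ n → (1ℚ - t ÷ n) ℚ.* n ≡ d
[1-t÷n]*n≡d {d} {t} {n} d+t≡n = begin
  (1ℚ - t ℚ.* 1/ n) ℚ.* n   ≡⟨ solve 3 (λ t i n → (con 1ℚ :- t :* i) :* n := n :- t :* (i :* n)) refl t (1/ n) n ⟩
  n - t ℚ.* (1/ n ℚ.* n)    ≡⟨ cong₂ (λ a b → a - t ℚ.* b) (sym d+t≡n) (ℚ.*-inverseˡ n) ⟩
  d ℚ.+ t - t ℚ.* 1ℚ        ≡⟨ solve 2 (λ d t → d :+ t :- t :* con 1ℚ := d) refl d t ⟩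
  d                         ∎
  where open ≡-Reasoning
        open ℚ-Solver.+-*-Solver

1÷'[1-θ÷'n]*[n∸θ]≡n : ∀ {θ n} → θ ℕ.< n →
                      (1ℚ ÷' (1ℚ - ℕ→ℚ θ ÷' ℕ→ℚ n)) ℚ.* ℕ→ℚ (n ∸ θ) ≡ ℕ→ℚ n
1÷'[1-θ÷'n]*[n∸θ]≡n {θ} {suc n} θ<n = begin
  (1ℚ ÷' x) ℚ.* ℕ→ℚ (suc n ∸ θ)   ≡⟨ cong ((1ℚ ÷' x) ℚ.*_) x*N≡D ⟨
  (1ℚ ÷' x) ℚ.* (x ℚ.* N)         ≡⟨ 1÷'x*[x*y]≡y x N x≢0 ⟩
  N                               ∎
  where
  open ≡-Reasoning
  N = ℕ→ℚ (suc n)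
  instance _ = ≢-nonZero (ℕ→ℚ-suc≢0 n)
  x = 1ℚ - ℕ→ℚ θ ÷' N
  x*N≡D : x ℚ.* N ≡ ℕ→ℚ (suc n ∸ θ)
  x*N≡D rewrite ÷'-≢0 (ℕ→ℚ θ) (ℕ→ℚ-suc≢0 n) =
    [1-t÷n]*n≡d (trans (sym (ℕ→ℚ-+ (suc n ∸ θ) θ)) (cong ℕ→ℚ (ℕ.m∸n+n≡m (ℕ.<⇒≤ θ<n))))
  x≢0 : x ≢ 0ℚ
  x≢0 x≡0 = ℕ→ℚ-suc≢0 (n ∸ θ) (begin
    ℕ→ℚ (suc (n ∸ θ)) ≡⟨ cong ℕ→ℚ (ℕ.+-∸-assoc 1 (ℕ.≤-pred θ<n)) ⟨
    ℕ→ℚ (suc n ∸ θ)   ≡⟨ x*N≡D ⟨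
    x ℚ.* N           ≡⟨ cong (ℚ._* N) x≡0 ⟩
    0ℚ ℚ.* N          ≡⟨ ℚ.*-zeroˡ N ⟩
    0ℚ                ∎)

ℕ→ℚ-÷'-≤⇔ : ∀ a b d → ℕ→ℚ a ÷' ℕ→ℚ (suc d) ≤ ℕ→ℚ b ⇔ a ℕ.≤ b * suc d
ℕ→ℚ-÷'-≤⇔ a b d rewrite ÷'-≢0 (ℕ→ℚ a) (ℕ→ℚ-suc≢0 d) =
  ⇔.trans (÷-≤⇔≤-* (ℕ→ℚ (suc d)))
          (subst (λ x → ℕ→ℚ a ≤ x ⇔ a ℕ.≤ b * suc d) (ℕ→ℚ-* b (suc d)) (mk⇔ ℕ→ℚ-cancel-≤ ℕ→ℚ-mono-≤))
  where instance _ = ℕ→ℚ-suc-positive d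

-- The case m = 0 holds because ℕ→ℚ a ÷' 0ℚ is the junk value 0ℚ.
ℕ→ℚ-÷'-≤ : ∀ a m k {c q} → 0 ℕ.< c → q ℚ.* ℕ→ℚ c ≡ ℕ→ℚ k → a * c ℕ.≤ k * m →
           ℕ→ℚ a ÷' ℕ→ℚ m ≤ q
ℕ→ℚ-÷'-≤ a zero k {suc c} {q} _ qC≡k _ = ℚ.*-cancelʳ-≤-pos (ℕ→ℚ (suc c)) (begin
  0ℚ ℚ.* ℕ→ℚ (suc c) ≡⟨ ℚ.*-zeroˡ (ℕ→ℚ (suc c)) ⟩
  ℕ→ℚ 0              ≤⟨ ℕ→ℚ-mono-≤ (ℕ.z≤n {k}) ⟩
  ℕ→ℚ k              ≡⟨ qC≡k ⟨
  q ℚ.* ℕ→ℚ (suc c)  ∎)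
  where open ℚ.≤-Reasoning
        instance _ = ℕ→ℚ-suc-positive c
ℕ→ℚ-÷'-≤ a (suc m) k {suc c} {q} _ qC≡k ac≤km rewrite ÷'-≢0 (ℕ→ℚ a) (ℕ→ℚ-suc≢0 m) =
  Equivalence.from (÷-≤⇔≤-* {ℕ→ℚ a} {q} M) (ℚ.*-cancelʳ-≤-pos C (begin
    ℕ→ℚ a ℚ.* C      ≡⟨ ℕ→ℚ-* a (suc c) ⟨
    ℕ→ℚ (a * suc c)  ≤⟨ ℕ→ℚ-mono-≤ ac≤km ⟩
    ℕ→ℚ (k * suc m)  ≡⟨ ℕ→ℚ-* k (suc m) ⟩
    ℕ→ℚ k ℚ.* M      ≡⟨ cong (ℚ._* M) qC≡k ⟨
    q ℚ.* C ℚ.* M    ≡⟨ ℚ-*.xy∙z≈xz∙y q C M ⟩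
    q ℚ.* M ℚ.* C    ∎))
  where open ℚ.≤-Reasoning
        M = ℕ→ℚ (suc m)
        C = ℕ→ℚ (suc c)
        instance _ = ℕ→ℚ-suc-positive m
                 _ = ℕ→ℚ-suc-positive c

_⪯_ : Word → Word → Set
_⪯_ = Prefix _≡_

prefix?⇒⪯ : ∀ u v → T (prefix? u v) → u ⪯ v
prefix?⇒⪯ []      _       _ = []
prefix?⇒⪯ (a ∷ u) (b ∷ v) h with a≡ᵇb , h′ ← Equivalence.to T-∧ h =
  ℕ.≡ᵇ⇒≡ a b a≡ᵇb ∷ prefix?⇒⪯ u v h′

⪯⇒prefix? : ∀ {u v} → u ⪯ v → T (prefix? u v)
⪯⇒prefix? []                  = _
⪯⇒prefix? (_∷_ {a} refl u⪯v) = Equivalence.from T-∧ (ℕ.≡⇒≡ᵇ a a refl , ⪯⇒prefix? u⪯v)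

⪯-refl : ∀ u → u ⪯ u
⪯-refl []      = []
⪯-refl (a ∷ u) = refl ∷ ⪯-refl u

⪯-++ : ∀ u {v} → u ⪯ (u ++ v)
⪯-++ []      = []
⪯-++ (a ∷ u) = refl ∷ ⪯-++ u

⪯-trans : ∀ {u v w} → u ⪯ v → v ⪯ w → u ⪯ w
⪯-trans = Prefix.trans trans

snoc-⋠-[] : ∀ u {a} → ¬ (u ++ [ a ]) ⪯ []
snoc-⋠-[] []      ()
snoc-⋠-[] (_ ∷ _) ()

siblings-⪯-≡ : ∀ u {a b w} → (u ++ [ a ]) ⪯ w → (u ++ [ b ]) ⪯ w → a ≡ b
siblings-⪯-≡ []      (refl ∷ _)    (refl ∷ _)    = refl
siblings-⪯-≡ (_ ∷ u) (refl ∷ ua⪯w) (refl ∷ ub⪯w) = siblings-⪯-≡ u ua⪯w ub⪯w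

filter-⪯-none : ∀ {w} xs → All (λ v → ¬ v ⪯ w) xs → filterᵇ (λ v → prefix? v w) xs ≡ []
filter-⪯-none {w} xs xs⋠w =
  filter-none (T? ∘ λ v → prefix? v w) (All.map (λ {v} v⋠w → v⋠w ∘ prefix?⇒⪯ v w) xs⋠w)

filter-⪯-under-∷ : ∀ c w xs → filterᵇ (λ v → prefix? (c ∷ v) (c ∷ w)) xs ≡ filterᵇ (λ v → prefix? v w) xs
filter-⪯-under-∷ c w xs rewrite Equivalence.to T-≡ (ℕ.≡⇒≡ᵇ c c refl) = refl

path : Word → Word → List Word
path u []      = []
path u (a ∷ x) = (u ++ [ a ]) ∷ path (u ++ [ a ]) x

path-⪰ : ∀ u x → All (u ⪯_) (path u x)
path-⪰ u []      = []
path-⪰ u (a ∷ x) = ⪯-++ u ∷ All.map (⪯-trans (⪯-++ u)) (path-⪰ (u ++ [ a ]) x)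

map-∷-path : ∀ c u x → map (c ∷_) (path u x) ≡ path (c ∷ u) x
map-∷-path c u []      = refl
map-∷-path c u (a ∷ x) = cong ((c ∷ u ++ [ a ]) ∷_) (map-∷-path c (u ++ [ a ]) x)

data Head≥ (c : ℕ) : Word → Set where
  head≥ : ∀ {d} v → c ℕ.≤ d → Head≥ c (d ∷ v)

children-Head≥ : ∀ c ts → All (Head≥ c) (nodesChildren c ts)
children-Head≥ c []       = []
children-Head≥ c (s ∷ ts) =
  All.++⁺ (All.map⁺ (All.universal (λ v → head≥ v ℕ.≤-refl) (nodes s)))
          (All.map (λ { (head≥ v c<d) → head≥ v (ℕ.<⇒≤ c<d) }) (children-Head≥ (suc c) ts))

Head≥⇒⋠ : ∀ {c a v w} → a ℕ.< c → Head≥ c v → ¬ v ⪯ (a ∷ w)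
Head≥⇒⋠ a<c (head≥ _ c≤a) (refl ∷ _) = ℕ.<⇒≱ a<c c≤a

mutual
  prefixes≡path : ∀ ts {w} → w ∈ ⟦ node ts ⟧ → filterᵇ (λ v → prefix? v w) (nodesChildren 1 ts) ≡ path [] w
  prefixes≡path ts (here refl)  = filter-⪯-none _ (All.map (λ { (head≥ _ _) () }) (children-Head≥ 1 ts))
  prefixes≡path ts (there w∈ts) = prefixes≡path-forest 1 ts w∈ts

  prefixes≡path-forest : ∀ c ts {w} → w ∈ nodesChildren c ts →
                         filterᵇ (λ v → prefix? v w) (nodesChildren c ts) ≡ path [] w
  prefixes≡path-forest c (s@(node ss) ∷ ts) w∈ with ∈-++⁻ (map (c ∷_) (nodes s)) w∈
  ... | inj₁ w∈s with ∈-map⁻ (c ∷_) w∈s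
  ...   | w , w∈s′ , refl = begin
    filterᵇ P (map (c ∷_) (nodes s) ++ rest)
      ≡⟨ filter-++ (T? ∘ P) (map (c ∷_) (nodes s)) rest ⟩
    filterᵇ P (map (c ∷_) (nodes s)) ++ filterᵇ P rest
      ≡⟨ cong₂ _++_ (filterᵇ-map P (c ∷_) (nodes s)) rest-none ⟩
    map (c ∷_) (filterᵇ (P ∘ (c ∷_)) (nodes s)) ++ []
      ≡⟨ ++-identityʳ _ ⟩
    map (c ∷_) (filterᵇ (P ∘ (c ∷_)) (nodes s))
      ≡⟨ cong (map (c ∷_)) (filter-⪯-under-∷ c w (nodes s)) ⟩
    map (c ∷_) ([] ∷ filterᵇ (λ v → prefix? v w) (nodesChildren 1 ss))
      ≡⟨ cong (λ vs → map (c ∷_) ([] ∷ vs)) (prefixes≡path ss w∈s′) ⟩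
    map (c ∷_) ([] ∷ path [] w)
      ≡⟨ cong ([ c ] ∷_) (map-∷-path c [] w) ⟩
    path [] (c ∷ w)
      ∎
    where
    open ≡-Reasoning
    P = λ v → prefix? v (c ∷ w)
    rest = nodesChildren (suc c) ts
    rest-none : filterᵇ P rest ≡ []
    rest-none = filter-⪯-none rest (All.map (Head≥⇒⋠ (ℕ.n<1+n c)) (children-Head≥ (suc c) ts))
  prefixes≡path-forest c (s@(node ss) ∷ ts) {w} w∈ | inj₂ w∈ts
    with All.lookup (children-Head≥ (suc c) ts) w∈ts
  ... | head≥ _ c<a = begin
    filterᵇ P (map (c ∷_) (nodes s) ++ rest)             ≡⟨ filter-++ (T? ∘ P) (map (c ∷_) (nodes s)) rest ⟩
    filterᵇ P (map (c ∷_) (nodes s)) ++ filterᵇ P rest   ≡⟨ cong (_++ filterᵇ P rest) first-none ⟩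
    filterᵇ P rest                                       ≡⟨ prefixes≡path-forest (suc c) ts w∈ts ⟩
    path [] w                                            ∎
    where
    open ≡-Reasoning
    P = λ v → prefix? v w
    rest = nodesChildren (suc c) ts
    first-none : filterᵇ P (map (c ∷_) (nodes s)) ≡ []
    first-none = filter-⪯-none {w} (map (c ∷_) (nodes s))
      (All.map⁺ (All.universal (λ { _ (refl ∷ _) → ℕ.<-irrefl refl c<a }) (nodes s)))

path⊆tree : ∀ ts {w} → w ∈ ⟦ node ts ⟧ → All (_∈ ⟦ node ts ⟧) (path [] w)
path⊆tree ts {w} w∈t = All.tabulate λ {v} v∈path →
  there (proj₁ (∈-filter⁻ (T? ∘ λ v → prefix? v w) (subst (v ∈_) (sym (prefixes≡path ts w∈t)) v∈path)))

θᶜ : Tree → Word → ℕ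
θᶜ t v = ∣ t ∣ ∸ θsize t v

∏θ ∏θᶜ : Tree → List Word → ℕ
∏θ  t vs = prod (map (θsize t) vs)
∏θᶜ t vs = prod (map (θᶜ t) vs)

Heavy : Tree → Word → Set
Heavy t v = ∣ t ∣ ℕ.≤ θsize t v * 2

heavy⇔ : ∀ t v → ℕ→ℚ ∣ t ∣ ÷' ℕ→ℚ 2 ≤ ℕ→ℚ (θsize t v) ⇔ Heavy t v
heavy⇔ t v = ℕ→ℚ-÷'-≤⇔ ∣ t ∣ (θsize t v) 1

θ≤∣∣ : ∀ t v → θsize t v ℕ.≤ ∣ t ∣
θ≤∣∣ t v = length-filter (T? ∘ prefix? v) ⟦ t ⟧

∏θᶜ≤^ : ∀ t us → ∏θᶜ t us ℕ.≤ ∣ t ∣ ^ length us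
∏θᶜ≤^ t = prod-map-≤-^ (λ v → ℕ.m∸n≤m ∣ t ∣ (θsize t v))

θ-antitone : ∀ t {u v} → u ⪯ v → θsize t v ℕ.≤ θsize t u
θ-antitone t {u} {v} u⪯v = length-mono-≤ (filter⁺ (T? ∘ prefix? v) (T? ∘ prefix? u)
  (λ { {w} refl v⪯w → ⪯⇒prefix? (⪯-trans u⪯v (prefix?⇒⪯ v w v⪯w)) }) (⊆-refl {x = ⟦ t ⟧}))

θ-snoc : ∀ ts u {a} →
         θsize (node ts) (u ++ [ a ]) ≡ length (filterᵇ (prefix? (u ++ [ a ])) (nodesChildren 1 ts))
θ-snoc ts u {a} =
  cong length (filter-reject (T? ∘ prefix? (u ++ [ a ])) (snoc-⋠-[] u ∘ prefix?⇒⪯ (u ++ [ a ]) []))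

θ-snoc< : ∀ t u {a} → θsize t (u ++ [ a ]) ℕ.< ∣ t ∣
θ-snoc< (node ts) u {a} rewrite θ-snoc ts u {a} =
  ℕ.s≤s (length-filter (T? ∘ prefix? (u ++ [ a ])) (nodesChildren 1 ts))

θ-siblings< : ∀ t u {a b} → a ≢ b → θsize t (u ++ [ a ]) + θsize t (u ++ [ b ]) ℕ.< ∣ t ∣
θ-siblings< (node ts) u {a} {b} a≢b rewrite θ-snoc ts u {a} | θ-snoc ts u {b} =
  ℕ.s≤s (length-filter-disjoint (T? ∘ prefix? (u ++ [ a ])) (T? ∘ prefix? (u ++ [ b ]))
           (λ {w} ua⪯w ub⪯w → a≢b (siblings-⪯-≡ u (prefix?⇒⪯ _ w ua⪯w) (prefix?⇒⪯ _ w ub⪯w)))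
           (nodesChildren 1 ts))

heavy-siblings-≡ : ∀ t u {a b} → Heavy t (u ++ [ a ]) → Heavy t (u ++ [ b ]) → a ≡ b
heavy-siblings-≡ t u {a} {b} heavy-a heavy-b with a ℕ.≟ b
... | yes a≡b = a≡b
... | no  a≢b = ⊥-elim (ℕ.<-irrefl refl (begin-strict
  n * 2           ≡⟨ n*2≡n+n n ⟩
  n + n           ≤⟨ ℕ.+-mono-≤ heavy-a heavy-b ⟩
  x * 2 + y * 2   ≡⟨ ℕ.*-distribʳ-+ 2 x y ⟨
  (x + y) * 2     <⟨ ℕ.*-monoˡ-< 2 (θ-siblings< t u a≢b) ⟩
  n * 2           ∎))
  where open ℕ.≤-Reasoning
        n = ∣ t ∣
        x = θsize t (u ++ [ a ])
        y = θsize t (u ++ [ b ])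

light⇒θ≤θᶜ : ∀ t {v} → ¬ Heavy t v → θsize t v ℕ.≤ θᶜ t v
light⇒θ≤θᶜ t {v} light = ℕ.m+n≤o⇒m≤o∸n (θsize t v)
  (subst (ℕ._≤ ∣ t ∣) (n*2≡n+n (θsize t v)) (ℕ.<⇒≤ (ℕ.≰⇒> light)))

light-∏θ≤∏θᶜ : ∀ t {u vs} → ¬ Heavy t u → All (u ⪯_) vs → ∏θ t vs ℕ.≤ ∏θᶜ t vs
light-∏θ≤∏θᶜ t {u} light u⪯vs = prod-map-mono-≤ (All.map (λ {v} → light-below v) u⪯vs)
  where
  light-below : ∀ v → u ⪯ v → θsize t v ℕ.≤ θᶜ t v
  light-below v u⪯v =
    light⇒θ≤θᶜ t {v} (λ heavy-v → light (ℕ.≤-trans heavy-v (ℕ.*-monoˡ-≤ 2 (θ-antitone t {u} {v} u⪯v))))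

-- The heavy path

light-path-ratio-≤ : ∀ t {u a} x us → ¬ Heavy t (u ++ [ a ]) →
                     ∏θ t (path u (a ∷ x)) * ∏θᶜ t us ℕ.≤ ∣ t ∣ ^ length us * ∏θᶜ t (path u (a ∷ x))
light-path-ratio-≤ t {u} {a} x us light = begin
  ∏θ t vs * ∏θᶜ t us             ≤⟨ ℕ.*-mono-≤ (light-∏θ≤∏θᶜ t light ua⪯vs) (∏θᶜ≤^ t us) ⟩
  ∏θᶜ t vs * ∣ t ∣ ^ length us   ≡⟨ ℕ.*-comm (∏θᶜ t vs) _ ⟩
  ∣ t ∣ ^ length us * ∏θᶜ t vs   ∎
  where
  open ℕ.≤-Reasoning
  vs = path u (a ∷ x)
  ua⪯vs : All ((u ++ [ a ]) ⪯_) vs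
  ua⪯vs = ⪯-refl (u ++ [ a ]) ∷ path-⪰ (u ++ [ a ]) x

path-ratio-≤ : ∀ t x {u us} → Chain t u us → All (_∈ ⟦ t ⟧) (path u x) →
               ∏θ t (path u x) * ∏θᶜ t us ℕ.≤ ∣ t ∣ ^ length us * ∏θᶜ t (path u x)
path-ratio-≤ t []      {us = us} _ _ =
  subst₂ ℕ._≤_ (sym (ℕ.*-identityˡ (∏θᶜ t us))) (sym (ℕ.*-identityʳ (∣ t ∣ ^ length us))) (∏θᶜ≤^ t us)
path-ratio-≤ t (a ∷ x) {u} (stop no-heavy) (ua∈t ∷ _) =
  light-path-ratio-≤ t x [] (no-heavy a ua∈t ∘ Equivalence.from (heavy⇔ t (u ++ [ a ])))
path-ratio-≤ t (a ∷ x) {u} (step {j = j} {us} _ heavy-j chain) (_ ∷ path∈t) with a ℕ.≟ j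
... | yes refl = *-mono-≤-interchange (θᶜ t (u ++ [ a ])) (θ≤∣∣ t (u ++ [ a ])) (path-ratio-≤ t x chain path∈t)
... | no  a≢j  = light-path-ratio-≤ t x ((u ++ [ j ]) ∷ us)
  (λ heavy-a → a≢j (heavy-siblings-≡ t u heavy-a (Equivalence.to (heavy⇔ t (u ++ [ j ])) heavy-j)))

chain-θ< : ∀ t {u us} → Chain t u us → All (λ v → θsize t v ℕ.< ∣ t ∣) us
chain-θ< t     (stop _)         = []
chain-θ< t {u} (step _ _ chain) = θ-snoc< t u ∷ chain-θ< t chain

∏θᶜ-positive : ∀ t {us} → All (λ v → θsize t v ℕ.< ∣ t ∣) us → 0 ℕ.< ∏θᶜ t us
∏θᶜ-positive t []           = ℕ.s≤s ℕ.z≤n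
∏θᶜ-positive t (θ<n ∷ θs<n) = ℕ.*-mono-≤ (ℕ.m<n⇒0<n∸m θ<n) (∏θᶜ-positive t θs<n)

bound-*-∏θᶜ : ∀ t {us} → All (λ v → θsize t v ℕ.< ∣ t ∣) us →
              bound t us ℚ.* ℕ→ℚ (∏θᶜ t us) ≡ ℕ→ℚ (∣ t ∣ ^ length us)
bound-*-∏θᶜ t []                    = ℚ.*-identityˡ (ℕ→ℚ 1)
bound-*-∏θᶜ t {v ∷ us} (θ<n ∷ θs<n) = begin
  f ℚ.* B ℚ.* ℕ→ℚ (θᶜ t v * C)           ≡⟨ cong (f ℚ.* B ℚ.*_) (ℕ→ℚ-* (θᶜ t v) C) ⟩
  f ℚ.* B ℚ.* (ℕ→ℚ (θᶜ t v) ℚ.* ℕ→ℚ C)   ≡⟨ ℚ-*.interchange f B (ℕ→ℚ (θᶜ t v)) (ℕ→ℚ C) ⟩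
  f ℚ.* ℕ→ℚ (θᶜ t v) ℚ.* (B ℚ.* ℕ→ℚ C)   ≡⟨ cong₂ ℚ._*_ (1÷'[1-θ÷'n]*[n∸θ]≡n θ<n) (bound-*-∏θᶜ t θs<n) ⟩
  ℕ→ℚ ∣ t ∣ ℚ.* ℕ→ℚ (∣ t ∣ ^ length us)   ≡⟨ ℕ→ℚ-* ∣ t ∣ (∣ t ∣ ^ length us) ⟨
  ℕ→ℚ (∣ t ∣ ^ suc (length us))          ∎
  where
  open ≡-Reasoning
  f = 1ℚ ÷' (1ℚ - ℕ→ℚ (θsize t v) ÷' ℕ→ℚ ∣ t ∣)
  B = bound t us
  C = ∏θᶜ t us

-- Centrality

offPath : Tree → Word → List Word
offPath t w = filterᵇ (λ v → not (prefix? v w)) ⟦ t ⟧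

φ-root : ∀ ts {w} → w ∈ ⟦ node ts ⟧ →
         φ (node ts) [] ≡ ∏θ (node ts) (path [] w) * ∏θ (node ts) (offPath (node ts) w)
φ-root ts {w} w∈t = begin
  ∏θ t (filterᵇ (λ v → not (prefix? v [])) R) * ∏θᶜ t (filterᵇ (λ v → nonEmpty v ∧ prefix? v []) R)
    ≡⟨ cong₂ (λ xs ys → ∏θ t xs * ∏θᶜ t ys)
         (filter-all  (T? ∘ λ v → not (prefix? v []))        (All.map (λ { (head≥ _ _) → _ })  nonroot))
         (filter-none (T? ∘ λ v → nonEmpty v ∧ prefix? v []) (All.map (λ { (head≥ _ _) () }) nonroot)) ⟩
  ∏θ t R * 1
    ≡⟨ ℕ.*-identityʳ (∏θ t R) ⟩
  ∏θ t R
    ≡⟨ prod-map-filter (θsize t) (λ v → prefix? v w) R ⟩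
  ∏θ t (filterᵇ (λ v → prefix? v w) R) * ∏θ t (offPath t w)
    ≡⟨ cong (λ xs → ∏θ t xs * ∏θ t (offPath t w)) (prefixes≡path ts w∈t) ⟩
  ∏θ t (path [] w) * ∏θ t (offPath t w)
    ∎
  where
  open ≡-Reasoning
  t = node ts
  R = nodesChildren 1 ts
  nonroot = children-Head≥ 1 ts

φ-at : ∀ ts {w} → w ∈ ⟦ node ts ⟧ →
       φ (node ts) w ≡ ∏θ (node ts) (offPath (node ts) w) * ∏θᶜ (node ts) (path [] w)
φ-at ts {w} w∈t = cong (λ xs → ∏θ (node ts) (offPath (node ts) w) * ∏θᶜ (node ts) xs) (begin
  filterᵇ (λ v → nonEmpty v ∧ prefix? v w) R ≡⟨ filterᵇ-cong (All.map (λ { (head≥ _ _) → refl }) nonroot) ⟩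
  filterᵇ (λ v → prefix? v w) R              ≡⟨ prefixes≡path ts w∈t ⟩
  path [] w                                  ∎)
  where
  open ≡-Reasoning
  R = nodesChildren 1 ts
  nonroot = children-Head≥ 1 ts

φ[]-*-∏θᶜ-≤ : ∀ t {us w} → Chain t [] us → w ∈ ⟦ t ⟧ →
              φ t [] * ∏θᶜ t us ℕ.≤ ∣ t ∣ ^ length us * φ t w
φ[]-*-∏θᶜ-≤ t@(node ts) {us} {w} chain w∈t = begin
  φ t [] * C    ≡⟨ cong (_* C) (φ-root ts w∈t) ⟩
  A * B * C     ≡⟨ ℕ-*.xy∙z≈y∙xz A B C ⟩
  B * (A * C)   ≤⟨ ℕ.*-monoʳ-≤ B (path-ratio-≤ t w chain (path⊆tree ts w∈t)) ⟩
  B * (K * Q)   ≡⟨ ℕ-*.x∙yz≈y∙xz B K Q ⟩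
  K * (B * Q)   ≡⟨ cong (K *_) (φ-at ts w∈t) ⟨
  K * φ t w     ∎
  where
  open ℕ.≤-Reasoning
  A = ∏θ t (path [] w)
  B = ∏θ t (offPath t w)
  C = ∏θᶜ t us
  K = ∣ t ∣ ^ length us
  Q = ∏θᶜ t (path [] w)

minφ-attained : ∀ t → ∃[ w ] w ∈ ⟦ t ⟧ × minφ t ≡ φ t w
minφ-attained t@(node ts) with foldr-selective ℕ.⊓-sel (φ t []) (map (φ t) ⟦ t ⟧)
... | inj₁ min≡φ[] = [] , here refl , trans (sym (foldr-map ℕ._⊓_ (φ t) (φ t []) ⟦ t ⟧)) min≡φ[]
... | inj₂ min∈φs with w , w∈t , min≡φw ← ∈-map⁻ (φ t) min∈φs =
  w , w∈t , trans (sym (foldr-map ℕ._⊓_ (φ t) (φ t []) ⟦ t ⟧)) min≡φw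

lemma2p3 : (t : Tree) (us : List Word) → Chain t [] us → Φ t ≤ bound t us
lemma2p3 t us chain with w , w∈t , minφ≡φw ← minφ-attained t =
  subst (λ m → ℕ→ℚ (φ t []) ÷' ℕ→ℚ m ≤ bound t us) (sym minφ≡φw)
    (ℕ→ℚ-÷'-≤ (φ t []) (φ t w) (∣ t ∣ ^ length us)
      (∏θᶜ-positive t θs<n) (bound-*-∏θᶜ t θs<n) (φ[]-*-∏θᶜ-≤ t chain w∈t))
  where θs<n = chain-θ< t chain
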